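{- For every nonnegative integer $n$, the Rogers--Szeg\H{o} polynomial $H_n(t)=\sum_{j=0}^{n}t^j\begin{bmatrix}n\\ j\end{bmatrix}_q$ satisfies \[ H_n(t)=\sum_{r=0}^{\lfloor n/2\rfloor} t^{2r}(-q/t;q^2)_r\,(-t;q^2)_{\lfloor (n+1)/2\rfloor-r}\begin{bmatrix}\lfloor n/2\rfloor\\ r\end{bmatrix}_{q^2}. \]
   Context: For $m\ge 0$, $(a;p)_m=\prod_{i=0}^{m-1}(1-ap^i)$. The $q$-binomial coefficient in base $p$ is $\begin{bmatrix}L\\ a\end{bmatrix}_p=\frac{(p;p)_L}{(p;p)_a(p;p)_{L-a}}$ for $a\in\{0,\dots,L\}$. -}

module Defs where

open import Data.Nat using (ℕ; zero; suc; _∸_; ⌊_/2⌋)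
open import Data.Rational using (ℚ; 0ℚ; 1ℚ; _+_; _*_; _-_; -_; _÷_; ≢-nonZero)
open import Relation.Binary.PropositionalEquality using (_≡_)
open import Relation.Nullary using (yes; no)
open import Data.Rational.Properties using (_≟_)

pow : ℚ → ℕ → ℚ
pow x zero    = 1ℚ
pow x (suc m) = x * pow x m

-- total division on ℚ (value 0 when the divisor is 0; only ever used
-- under hypotheses guaranteeing a nonzero divisor)
divℚ : ℚ → ℚ → ℚ
divℚ x y with y ≟ 0ℚ
... | yes _  = 0ℚ
... | no y≢0 = _÷_ x y {{≢-nonZero y≢0}}

poch : ℚ → ℚ → ℕ → ℚ
poch a p zero    = 1ℚ
poch a p (suc m) = poch a p m * (1ℚ - a * pow p m)

qbin : ℚ → ℕ → ℕ → ℚ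
qbin p L a = divℚ (poch p p L) (poch p p a * poch p p (L ∸ a))

sumTo : ℕ → (ℕ → ℚ) → ℚ
sumTo zero    f = f 0
sumTo (suc m) f = sumTo m f + f (suc m)

H : ℚ → ℕ → ℚ → ℚ
H q n t = sumTo n (λ j → pow t j * qbin q n j)

RHS : ℚ → ℕ → ℚ → ℚ
RHS q n t = sumTo ⌊ n /2⌋ (λ r →
  pow t (r Data.Nat.+ r) * poch (- divℚ q t) (q * q) r
    * poch (- t) (q * q) (⌊ suc n /2⌋ ∸ r) * qbin (q * q) ⌊ n /2⌋ r)

-- Both sides satisfy the Rogers–Szegő recurrence
--   X (n + 2) = (1 + t) X (n + 1) − t (1 − q^(n+1)) X n
-- and agree at n = 0 and n = 1. For H the recurrence holds termwise, by the
-- q-Pascal rule together with the absorption identity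
--   (1 − p^(d+1)) [r+d+1, r]_p = (1 − p^(r+d+1)) [r+d, r]_p.
-- The right side is G ⌊n/2⌋ ⌈n/2⌉, where
--   G m k = Σ_{r ≤ m} t^(2r) (−q/t; q²)_r (−t; q²)_(k−r) [m, r]_(q²).
-- Passing from 2m to 2m + 2 raises m: q²-Pascal splits off an extra term, which
-- the factor (−q/t; q²) absorbs because q = t · (q/t). Passing from 2m + 1 to
-- 2m + 3 raises k, and absorption does the rest. Every q-binomial identity is
-- checked after multiplying through by (p;p)_a (p;p)_b, which the hypotheses
-- keep nonzero.

module Submission where

open import Defs
open import Data.Nat using (ℕ; ⌊_/2⌋)
open import Data.Rational using (ℚ; 0ℚ; _*_)
open import Relation.Binary.PropositionalEquality using (_≡_; _≢_)

open import Data.Nat as ℕ using (zero; suc; _∸_; _≤_; _<_; _≤′_; ≤′-refl; ≤′-step; s≤s)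
import Data.Nat.Properties as ℕ
open import Data.Rational using (1ℚ; _+_; _-_; -_; 1/_; ≢-nonZero)
open import Data.Rational.Properties
  using (_≟_; 1≢0; +-*-commutativeRing; +-assoc; *-comm; *-assoc; *-identityˡ; *-identityʳ; *-inverseˡ; *-inverseʳ; *-zeroˡ)
open import Data.Product using (_×_; _,_; proj₂)
open import Level using (0ℓ)
open import Relation.Binary.PropositionalEquality
  using (refl; sym; trans; cong; cong₂; subst; module ≡-Reasoning)
open import Relation.Nullary using (yes; no)
open import Relation.Nullary.Decidable using (dec⇒maybe)
open import Data.Empty using (⊥-elim)
open import Tactic.RingSolver using (solve-∀)
open import Tactic.RingSolver.Core.AlmostCommutativeRing
  using (AlmostCommutativeRing; fromCommutativeRing)
open import Function.Base using (_∘_)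
open ≡-Reasoning

-- The zero test lets the solver drop cancelled monomials; without it equal
-- polynomials can have different normal forms.
ℚ-ring : AlmostCommutativeRing 0ℓ 0ℓ
ℚ-ring = fromCommutativeRing +-*-commutativeRing (λ x → dec⇒maybe (0ℚ ≟ x))

*-cancelʳ-≢0 : ∀ {a b} y → y ≢ 0ℚ → a * y ≡ b * y → a ≡ b
*-cancelʳ-≢0 {a} {b} y y≢0 ay≡by = begin
    a             ≡⟨ *-*1/-cancel a ⟨
    a * y * 1/ y  ≡⟨ cong (_* 1/ y) ay≡by ⟩
    b * y * 1/ y  ≡⟨ *-*1/-cancel b ⟩
    b             ∎
  where
    instance _ = ≢-nonZero y≢0
    *-*1/-cancel : ∀ x → x * y * 1/ y ≡ x
    *-*1/-cancel x = trans (*-assoc x y (1/ y)) (trans (cong (x *_) (*-inverseʳ y)) (*-identityʳ x))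

*-≢0 : ∀ {a b} → a ≢ 0ℚ → b ≢ 0ℚ → a * b ≢ 0ℚ
*-≢0 {a} {b} a≢0 b≢0 ab≡0 = b≢0 (*-cancelʳ-≢0 a a≢0 (begin
    b * a   ≡⟨ *-comm b a ⟩
    a * b   ≡⟨ ab≡0 ⟩
    0ℚ      ≡⟨ *-zeroˡ a ⟨
    0ℚ * a  ∎))

divℚ-*-cancel : ∀ x {y} → y ≢ 0ℚ → divℚ x y * y ≡ x
divℚ-*-cancel x {y} y≢0 with y ≟ 0ℚ
... | yes y≡0  = ⊥-elim (y≢0 y≡0)
... | no  y≢0′ = trans (*-assoc x (1/ y) y) (trans (cong (x *_) (*-inverseˡ y)) (*-identityʳ x))
  where instance _ = ≢-nonZero y≢0′

pow-+ : ∀ x a b → pow x (a ℕ.+ b) ≡ pow x a * pow x b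
pow-+ x zero    b = sym (*-identityˡ (pow x b))
pow-+ x (suc a) b = trans (cong (x *_) (pow-+ x a b)) (sym (*-assoc x (pow x a) (pow x b)))

pow-square : ∀ x m → pow (x * x) m ≡ pow x (m ℕ.+ m)
pow-square x zero    = refl
pow-square x (suc m) = begin
    x * x * pow (x * x) m      ≡⟨ cong (x * x *_) (pow-square x m) ⟩
    x * x * pow x (m ℕ.+ m)    ≡⟨ *-assoc x x (pow x (m ℕ.+ m)) ⟩
    x * (x * pow x (m ℕ.+ m))  ≡⟨ cong (λ k → x * pow x k) (ℕ.+-suc m m) ⟨
    x * pow x (m ℕ.+ suc m)    ∎

poch-≢0-pred : ∀ a p m → poch a p (suc m) ≢ 0ℚ → poch a p m ≢ 0ℚ
poch-≢0-pred a p m h pₘ≡0 = h (trans (cong (_* (1ℚ - a * pow p m)) pₘ≡0) (*-zeroˡ (1ℚ - a * pow p m)))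

poch-≢0-≤ : ∀ a p {k m} → k ≤ m → poch a p m ≢ 0ℚ → poch a p k ≢ 0ℚ
poch-≢0-≤ a p {k} k≤m = go (ℕ.≤⇒≤′ k≤m)
  where
    go : ∀ {m} → k ≤′ m → poch a p m ≢ 0ℚ → poch a p k ≢ 0ℚ
    go         ≤′-refl        h = h
    go {suc m} (≤′-step k≤′m) h = go k≤′m (poch-≢0-pred a p m h)

pochs-≢0 : ∀ p {n} a b → a ℕ.+ b ≡ n → poch p p n ≢ 0ℚ → poch p p a * poch p p b ≢ 0ℚ
pochs-≢0 p a b refl h = *-≢0 (poch-≢0-≤ p p (ℕ.m≤m+n a b) h) (poch-≢0-≤ p p (ℕ.m≤n+m b a) h)

qbin*pochs≡poch : ∀ p {n} a b → a ℕ.+ b ≡ n → poch p p n ≢ 0ℚ →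
  qbin p n a * (poch p p a * poch p p b) ≡ poch p p n
qbin*pochs≡poch p a b refl h = begin
    divℚ (poch p p (a ℕ.+ b)) (poch p p a * poch p p (a ℕ.+ b ∸ a)) * (poch p p a * poch p p b)
      ≡⟨ cong (λ k → divℚ (poch p p (a ℕ.+ b)) (poch p p a * poch p p k) * (poch p p a * poch p p b))
              (ℕ.m+n∸m≡n a b) ⟩
    divℚ (poch p p (a ℕ.+ b)) (poch p p a * poch p p b) * (poch p p a * poch p p b)
      ≡⟨ divℚ-*-cancel (poch p p (a ℕ.+ b)) (pochs-≢0 p a b refl h) ⟩
    poch p p (a ℕ.+ b) ∎

qbin-unique : ∀ p {n x} a b → a ℕ.+ b ≡ n → poch p p n ≢ 0ℚ →
  x * (poch p p a * poch p p b) ≡ poch p p n → qbin p n a ≡ x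
qbin-unique p a b a+b≡n h e =
  *-cancelʳ-≢0 _ (pochs-≢0 p a b a+b≡n h) (trans (qbin*pochs≡poch p a b a+b≡n h) (sym e))

qbin-n-0 : ∀ p n → poch p p n ≢ 0ℚ → qbin p n 0 ≡ 1ℚ
qbin-n-0 p n h = qbin-unique p 0 n refl h (trans (*-identityˡ _) (*-identityˡ _))

qbin-n-n : ∀ p n → poch p p n ≢ 0ℚ → qbin p n n ≡ 1ℚ
qbin-n-n p n h = qbin-unique p n 0 (ℕ.+-identityʳ n) h (trans (*-identityˡ _) (*-identityʳ _))

qbin-pascal : ∀ p s e → poch p p (suc (suc (s ℕ.+ e))) ≢ 0ℚ →
  qbin p (suc (suc (s ℕ.+ e))) (suc s)
    ≡ qbin p (suc (s ℕ.+ e)) (suc s) + pow p (suc e) * qbin p (suc (s ℕ.+ e)) s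
qbin-pascal p s e h = qbin-unique p (suc s) (suc e) (cong suc (ℕ.+-suc s e)) h (begin
    (X + p * pe * Z) * (Ps * (1ℚ - p * ps) * (Pe * (1ℚ - p * pe)))
      ≡⟨ expand p ps pe Ps Pe X Z ⟩
    X * (Ps * (1ℚ - p * ps) * Pe) * (1ℚ - p * pe) + p * pe * (Z * (Ps * (Pe * (1ℚ - p * pe)))) * (1ℚ - p * ps)
      ≡⟨ cong₂ (λ x z → x * (1ℚ - p * pe) + p * pe * z * (1ℚ - p * ps))
               (qbin*pochs≡poch p (suc s) e refl h′) (qbin*pochs≡poch p s (suc e) (ℕ.+-suc s e) h′) ⟩
    P * (1ℚ - p * pe) + p * pe * P * (1ℚ - p * ps)
      ≡⟨ collect p ps pe P ⟩
    P * (1ℚ - p * (p * (ps * pe)))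
      ≡⟨ cong (λ x → P * (1ℚ - p * (p * x))) (pow-+ p s e) ⟨
    poch p p (suc (suc (s ℕ.+ e))) ∎)
  where
    h′ = poch-≢0-pred p p (suc (s ℕ.+ e)) h
    X = qbin p (suc (s ℕ.+ e)) (suc s)
    Z = qbin p (suc (s ℕ.+ e)) s
    P = poch p p (suc (s ℕ.+ e))
    Ps = poch p p s
    Pe = poch p p e
    ps = pow p s
    pe = pow p e
    expand : ∀ p ps pe Ps Pe X Z →
      (X + p * pe * Z) * (Ps * (1ℚ - p * ps) * (Pe * (1ℚ - p * pe)))
        ≡ X * (Ps * (1ℚ - p * ps) * Pe) * (1ℚ - p * pe) + p * pe * (Z * (Ps * (Pe * (1ℚ - p * pe)))) * (1ℚ - p * ps)
    expand = solve-∀ ℚ-ring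
    collect : ∀ p ps pe P → P * (1ℚ - p * pe) + p * pe * P * (1ℚ - p * ps) ≡ P * (1ℚ - p * (p * (ps * pe)))
    collect = solve-∀ ℚ-ring

qbin-absorb : ∀ p r d → poch p p (suc (r ℕ.+ d)) ≢ 0ℚ →
  (1ℚ - p * pow p d) * qbin p (suc (r ℕ.+ d)) r ≡ (1ℚ - p * pow p (r ℕ.+ d)) * qbin p (r ℕ.+ d) r
qbin-absorb p r d h = *-cancelʳ-≢0 (Pr * Pd) (pochs-≢0 p r d refl h′) (begin
    (1ℚ - p * pd) * B₁ * (Pr * Pd)   ≡⟨ rearrange (1ℚ - p * pd) B₁ Pr Pd ⟩
    B₁ * (Pr * (Pd * (1ℚ - p * pd)))  ≡⟨ qbin*pochs≡poch p r (suc d) (ℕ.+-suc r d) h ⟩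
    poch p p (suc (r ℕ.+ d))          ≡⟨ cong (_* (1ℚ - p * prd)) (qbin*pochs≡poch p r d refl h′) ⟨
    B₀ * (Pr * Pd) * (1ℚ - p * prd)   ≡⟨ rearrange′ (1ℚ - p * prd) B₀ Pr Pd ⟩
    (1ℚ - p * prd) * B₀ * (Pr * Pd)   ∎)
  where
    h′ = poch-≢0-pred p p (r ℕ.+ d) h
    B₁ = qbin p (suc (r ℕ.+ d)) r
    B₀ = qbin p (r ℕ.+ d) r
    Pr = poch p p r
    Pd = poch p p d
    pd = pow p d
    prd = pow p (r ℕ.+ d)
    rearrange : ∀ c B Pr Pd → c * B * (Pr * Pd) ≡ B * (Pr * (Pd * c))
    rearrange = solve-∀ ℚ-ring
    rearrange′ : ∀ c B Pr Pd → B * (Pr * Pd) * c ≡ c * B * (Pr * Pd)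
    rearrange′ = solve-∀ ℚ-ring

qbin-three-term : ∀ p j k → poch p p (suc (suc (j ℕ.+ k))) ≢ 0ℚ →
  qbin p (suc (suc (j ℕ.+ k))) (suc j)
    ≡ qbin p (suc (j ℕ.+ k)) (suc j) + qbin p (suc (j ℕ.+ k)) j
      - (1ℚ - p * pow p (j ℕ.+ k)) * qbin p (j ℕ.+ k) j
qbin-three-term p j k h = begin
    qbin p (suc (suc (j ℕ.+ k))) (suc j)   ≡⟨ qbin-pascal p j k h ⟩
    X + p * pk * Z                         ≡⟨ shift X Z p pk ⟩
    X + Z - (1ℚ - p * pk) * Z              ≡⟨ cong (λ y → X + Z - y) (qbin-absorb p j k (poch-≢0-pred p p (suc (j ℕ.+ k)) h)) ⟩
    X + Z - (1ℚ - p * pow p (j ℕ.+ k)) * qbin p (j ℕ.+ k) j ∎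
  where
    X = qbin p (suc (j ℕ.+ k)) (suc j)
    Z = qbin p (suc (j ℕ.+ k)) j
    pk = pow p k
    shift : ∀ X Z p pk → X + p * pk * Z ≡ X + Z - (1ℚ - p * pk) * Z
    shift = solve-∀ ℚ-ring

suc[m+n]∸m≡suc[n] : ∀ m n → suc (m ℕ.+ n) ∸ m ≡ suc n
suc[m+n]∸m≡suc[n] m n = trans (ℕ.+-∸-assoc 1 (ℕ.m≤m+n m n)) (cong suc (ℕ.m+n∸m≡n m n))

qbin-pascal′ : ∀ p s m → s < m → poch p p (suc m) ≢ 0ℚ →
  qbin p (suc m) (suc s) ≡ qbin p m (suc s) + pow p (m ∸ s) * qbin p m s
qbin-pascal′ p s m s<m h with ℕ.m≤n⇒∃[o]m+o≡n s<m
... | e , refl = trans (qbin-pascal p s e h)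
  (cong (λ k → qbin p (suc (s ℕ.+ e)) (suc s) + pow p k * qbin p (suc (s ℕ.+ e)) s) (sym (suc[m+n]∸m≡suc[n] s e)))

sumTo-cong : ∀ n {f g : ℕ → ℚ} → (∀ j → j ≤ n → f j ≡ g j) → sumTo n f ≡ sumTo n g
sumTo-cong zero    f≗g = f≗g 0 ℕ.z≤n
sumTo-cong (suc n) f≗g =
  cong₂ _+_ (sumTo-cong n (λ j j≤n → f≗g j (ℕ.m≤n⇒m≤1+n j≤n))) (f≗g (suc n) ℕ.≤-refl)

sumTo-unfoldˡ : ∀ n f → sumTo (suc n) f ≡ f 0 + sumTo n (λ j → f (suc j))
sumTo-unfoldˡ zero    f = refl
sumTo-unfoldˡ (suc n) f = begin
    sumTo (suc n) f + f (suc (suc n))                     ≡⟨ cong (_+ f (suc (suc n))) (sumTo-unfoldˡ n f) ⟩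
    f 0 + sumTo n (λ j → f (suc j)) + f (suc (suc n))     ≡⟨ +-assoc (f 0) _ _ ⟩
    f 0 + (sumTo n (λ j → f (suc j)) + f (suc (suc n)))   ∎

sumTo-+ : ∀ n f g → sumTo n (λ j → f j + g j) ≡ sumTo n f + sumTo n g
sumTo-+ zero    f g = refl
sumTo-+ (suc n) f g = trans (cong (_+ (f (suc n) + g (suc n))) (sumTo-+ n f g))
  (+-interchange (sumTo n f) (sumTo n g) (f (suc n)) (g (suc n)))
  where
    +-interchange : ∀ a b c d → (a + b) + (c + d) ≡ (a + c) + (b + d)
    +-interchange = solve-∀ ℚ-ring

sumTo-linear : ∀ n a b f g → sumTo n (λ j → a * f j - b * g j) ≡ a * sumTo n f - b * sumTo n g
sumTo-linear zero    a b f g = refl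
sumTo-linear (suc n) a b f g = trans (cong (_+ (a * f (suc n) - b * g (suc n))) (sumTo-linear n a b f g))
  (collect a b (sumTo n f) (sumTo n g) (f (suc n)) (g (suc n)))
  where
    collect : ∀ a b F G x y → (a * F - b * G) + (a * x - b * y) ≡ a * (F + x) - b * (G + y)
    collect = solve-∀ ℚ-ring

sumTo-pascal : ∀ m (f g d : ℕ → ℚ) → f 0 ≡ g 0 → (∀ s → s < m → f (suc s) ≡ g (suc s) + d s) →
  f (suc m) ≡ d m → sumTo (suc m) f ≡ sumTo m g + sumTo m d
sumTo-pascal zero    f g d f₀ _ f₁ = cong₂ _+_ f₀ f₁
sumTo-pascal (suc m) f g d f₀ fₛ fₘ = begin
    sumTo (suc m) f + f (suc (suc m))
      ≡⟨ cong₂ _+_ (sumTo-unfoldˡ m f) fₘ ⟩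
    f 0 + sumTo m (λ s → f (suc s)) + d (suc m)
      ≡⟨ cong₂ (λ x y → x + y + d (suc m)) f₀ (sumTo-cong m (λ s s≤m → fₛ s (s≤s s≤m))) ⟩
    g 0 + sumTo m (λ s → g (suc s) + d s) + d (suc m)
      ≡⟨ cong (λ x → g 0 + x + d (suc m)) (sumTo-+ m (λ s → g (suc s)) d) ⟩
    g 0 + (sumTo m (λ s → g (suc s)) + sumTo m d) + d (suc m)
      ≡⟨ regroup (g 0) _ _ _ ⟩
    (g 0 + sumTo m (λ s → g (suc s))) + (sumTo m d + d (suc m))
      ≡⟨ cong (_+ sumTo (suc m) d) (sumTo-unfoldˡ m g) ⟨
    sumTo (suc m) g + sumTo (suc m) d ∎
  where
    regroup : ∀ a b c d → a + (b + c) + d ≡ (a + b) + (c + d)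
    regroup = solve-∀ ℚ-ring

second-order-recurrence-unique : ∀ {a ℓ} {A : Set a} (P : ℕ → Set ℓ) → (∀ n → P (suc n) → P n) →
  (step : ℕ → A → A → A) (f g : ℕ → A) → f 0 ≡ g 0 → (P 1 → f 1 ≡ g 1) →
  (∀ n → P (suc (suc n)) → f (suc (suc n)) ≡ step n (f (suc n)) (f n)) →
  (∀ n → P (suc (suc n)) → g (suc (suc n)) ≡ step n (g (suc n)) (g n)) →
  ∀ n → P n → f n ≡ g n
second-order-recurrence-unique P P-pred step f g f₀≡g₀ f₁≡g₁ f-rec g-rec = agree
  where
    consecutive : ∀ n → P (suc n) → f n ≡ g n × f (suc n) ≡ g (suc n)
    consecutive zero    P₁ = f₀≡g₀ , f₁≡g₁ P₁
    consecutive (suc n) P₂ with consecutive n (P-pred (suc n) P₂)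
    ... | fₙ≡gₙ , fₙ₊₁≡gₙ₊₁ = fₙ₊₁≡gₙ₊₁ , (begin
        f (suc (suc n))           ≡⟨ f-rec n P₂ ⟩
        step n (f (suc n)) (f n)  ≡⟨ cong₂ (step n) fₙ₊₁≡gₙ₊₁ fₙ≡gₙ ⟩
        step n (g (suc n)) (g n)  ≡⟨ g-rec n P₂ ⟨
        g (suc (suc n))           ∎)
    agree : ∀ n → P n → f n ≡ g n
    agree zero    _  = f₀≡g₀
    agree (suc n) Pₙ = proj₂ (consecutive n Pₙ)

recurrenceStep : ℚ → ℚ → ℕ → ℚ → ℚ → ℚ
recurrenceStep q t n x₁ x₀ = (1ℚ + t) * x₁ - t * (1ℚ - q * pow q n) * x₀

H-term-recurrence : ∀ q t j n → j ≤ n → poch q q (suc (suc n)) ≢ 0ℚ →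
  pow t (suc j) * qbin q (suc (suc n)) (suc j)
    ≡ pow t (suc j) * qbin q (suc n) (suc j)
      + (t * (pow t j * qbin q (suc n) j) - t * (1ℚ - q * pow q n) * (pow t j * qbin q n j))
H-term-recurrence q t j n j≤n h with ℕ.m≤n⇒∃[o]m+o≡n j≤n
... | k , refl = trans (cong (pow t (suc j) *_) (qbin-three-term q j k h))
  (distribute t (pow t j) (qbin q (suc (j ℕ.+ k)) (suc j)) (qbin q (suc (j ℕ.+ k)) j)
              (1ℚ - q * pow q (j ℕ.+ k)) (qbin q (j ℕ.+ k) j))
  where
    distribute : ∀ t x X Y c W → t * x * (X + Y - c * W) ≡ t * x * X + (t * (x * Y) - t * c * (x * W))
    distribute = solve-∀ ℚ-ring

binomial-sum-unfoldˡ : ∀ q t N n → poch q q N ≢ 0ℚ →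
  sumTo (suc n) (λ j → pow t j * qbin q N j) ≡ 1ℚ + sumTo n (λ j → pow t (suc j) * qbin q N (suc j))
binomial-sum-unfoldˡ q t N n h = trans (sumTo-unfoldˡ n (λ j → pow t j * qbin q N j))
  (cong (_+ sumTo n (λ j → pow t (suc j) * qbin q N (suc j))) (trans (*-identityˡ (qbin q N 0)) (qbin-n-0 q N h)))

H-unfoldʳ : ∀ q t n → poch q q (suc n) ≢ 0ℚ →
  H q (suc n) t ≡ sumTo n (λ j → pow t j * qbin q (suc n) j) + pow t (suc n)
H-unfoldʳ q t n h = cong (sumTo n (λ j → pow t j * qbin q (suc n) j) +_)
  (trans (cong (pow t (suc n) *_) (qbin-n-n q (suc n) h)) (*-identityʳ (pow t (suc n))))

H-recurrence : ∀ q t n → poch q q (suc (suc n)) ≢ 0ℚ →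
  H q (suc (suc n)) t ≡ recurrenceStep q t n (H q (suc n) t) (H q n t)
H-recurrence q t n h = begin
    H q (suc (suc n)) t
      ≡⟨ H-unfoldʳ q t (suc n) h ⟩
    sumTo (suc n) (λ j → pow t j * qbin q (suc (suc n)) j) + t * x
      ≡⟨ cong (_+ t * x) (binomial-sum-unfoldˡ q t (suc (suc n)) n h) ⟩
    1ℚ + sumTo n (λ j → pow t (suc j) * qbin q (suc (suc n)) (suc j)) + t * x
      ≡⟨ cong (λ y → 1ℚ + y + t * x) (begin
           sumTo n (λ j → pow t (suc j) * qbin q (suc (suc n)) (suc j))
             ≡⟨ sumTo-cong n (λ j j≤n → H-term-recurrence q t j n j≤n h) ⟩
           sumTo n (λ j → A j + (t * B j - c * C j))
             ≡⟨ sumTo-+ n A (λ j → t * B j - c * C j) ⟩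
           ΣA + sumTo n (λ j → t * B j - c * C j)
             ≡⟨ cong (ΣA +_) (sumTo-linear n t c B C) ⟩
           ΣA + (t * ΣB - c * ΣC) ∎) ⟩
    1ℚ + (ΣA + (t * ΣB - c * ΣC)) + t * x
      ≡⟨ regroup t x c ΣA ΣB ΣC ⟩
    (1ℚ + ΣA) + t * (ΣB + x) - c * ΣC
      ≡⟨ cong₂ (λ a b → a + t * b - c * ΣC) (binomial-sum-unfoldˡ q t (suc n) n h′) (H-unfoldʳ q t n h′) ⟨
    H q (suc n) t + t * H q (suc n) t - c * ΣC
      ≡⟨ factor t (H q (suc n) t) c ΣC ⟩
    recurrenceStep q t n (H q (suc n) t) (H q n t) ∎
  where
    h′ = poch-≢0-pred q q (suc n) h
    x = pow t (suc n)
    c = t * (1ℚ - q * pow q n)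
    A B C : ℕ → ℚ
    A j = pow t (suc j) * qbin q (suc n) (suc j)
    B j = pow t j * qbin q (suc n) j
    C j = pow t j * qbin q n j
    ΣA = sumTo n A
    ΣB = sumTo n B
    ΣC = sumTo n C
    regroup : ∀ t x c ΣA ΣB ΣC → 1ℚ + (ΣA + (t * ΣB - c * ΣC)) + t * x ≡ (1ℚ + ΣA) + t * (ΣB + x) - c * ΣC
    regroup = solve-∀ ℚ-ring
    factor : ∀ t X c Y → X + t * X - c * Y ≡ (1ℚ + t) * X - c * Y
    factor = solve-∀ ℚ-ring

module _ (q t : ℚ) where
  private
    p = q * q
    u = divℚ q t

  G-term : ℕ → ℕ → ℕ → ℚ
  G-term m k r = pow t (r ℕ.+ r) * poch (- u) p r * poch (- t) p (k ∸ r) * qbin p m r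

  G : ℕ → ℕ → ℚ
  G m k = sumTo m (G-term m k)

  G-term-offset : ∀ m {k} r e → r ℕ.+ e ≡ k →
    G-term m k r ≡ pow t (r ℕ.+ r) * poch (- u) p r * poch (- t) p e * qbin p m r
  G-term-offset m r e refl =
    cong (λ i → pow t (r ℕ.+ r) * poch (- u) p r * poch (- t) p i * qbin p m r) (ℕ.m+n∸m≡n r e)

  pascal-excess : ℕ → ℕ → ℚ
  pascal-excess m s = pow t (suc s ℕ.+ suc s) * poch (- u) p (suc s) * poch (- t) p (m ∸ s) * (pow p (m ∸ s) * qbin p m s)

  G-term-pascal : ∀ m s → s < m → poch p p (suc m) ≢ 0ℚ →
    G-term (suc m) (suc m) (suc s) ≡ G-term m (suc m) (suc s) + pascal-excess m s
  G-term-pascal m s s<m h = trans (cong (F * E *_) (qbin-pascal′ p s m s<m h))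
      (distribute F E (qbin p m (suc s)) (pow p (m ∸ s)) (qbin p m s))
    where
      F = pow t (suc s ℕ.+ suc s) * poch (- u) p (suc s)
      E = poch (- t) p (m ∸ s)
      distribute : ∀ F E X w Z → F * E * (X + w * Z) ≡ F * E * X + F * E * (w * Z)
      distribute = solve-∀ ℚ-ring

  pascal-excess-split : ∀ m s → s ≤ m → t ≢ 0ℚ →
    pascal-excess m s ≡ t * G-term m (suc m) s - t * (1ℚ - q * pow p m) * G-term m m s
  pascal-excess-split m s s≤m t≢0 with ℕ.m≤n⇒∃[o]m+o≡n s≤m
  ... | e , refl = begin
      pascal-excess (s ℕ.+ e) s
        ≡⟨ cong₂ (λ i j → t * pow t i * poch (- u) p (suc s) * poch (- t) p j * (pow p j * B))
                 (ℕ.+-suc s s) (ℕ.m+n∸m≡n s e) ⟩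
      t * (t * T) * (U * (1ℚ - - u * ps)) * E * (pe * B)
        ≡⟨ excess-identity t u T U E B ps pe ⟩
      t * (T * U * (E * (1ℚ - - t * pe)) * B) - t * (1ℚ - t * u * (ps * pe)) * (T * U * E * B)
        ≡⟨ cong₂ (λ x y → t * (T * U * (E * (1ℚ - - t * pe)) * B) - t * (1ℚ - x * y) * (T * U * E * B))
                 (trans (*-comm t u) (divℚ-*-cancel q t≢0)) (sym (pow-+ p s e)) ⟩
      t * (T * U * (E * (1ℚ - - t * pe)) * B) - t * (1ℚ - q * pow p (s ℕ.+ e)) * (T * U * E * B)
        ≡⟨ cong₂ (λ x y → t * x - t * (1ℚ - q * pow p (s ℕ.+ e)) * y)
                 (sym (G-term-offset (s ℕ.+ e) s (suc e) (ℕ.+-suc s e))) (sym (G-term-offset (s ℕ.+ e) s e refl)) ⟩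
      t * G-term (s ℕ.+ e) (suc (s ℕ.+ e)) s - t * (1ℚ - q * pow p (s ℕ.+ e)) * G-term (s ℕ.+ e) (s ℕ.+ e) s ∎
    where
      T = pow t (s ℕ.+ s)
      U = poch (- u) p s
      E = poch (- t) p e
      B = qbin p (s ℕ.+ e) s
      ps = pow p s
      pe = pow p e
      excess-identity : ∀ t u T U E B ps pe →
        t * (t * T) * (U * (1ℚ - - u * ps)) * E * (pe * B)
          ≡ t * (T * U * (E * (1ℚ - - t * pe)) * B) - t * (1ℚ - t * u * (ps * pe)) * (T * U * E * B)
      excess-identity = solve-∀ ℚ-ring

  G-even-step : ∀ m → t ≢ 0ℚ → poch p p (suc m) ≢ 0ℚ →
    G (suc m) (suc m) ≡ recurrenceStep q t (m ℕ.+ m) (G m (suc m)) (G m m)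
  G-even-step m t≢0 h = begin
      G (suc m) (suc m)
        ≡⟨ sumTo-pascal m (G-term (suc m) (suc m)) (G-term m (suc m)) (pascal-excess m)
                        bottom (λ s s<m → G-term-pascal m s s<m h) top ⟩
      G m (suc m) + sumTo m (pascal-excess m)
        ≡⟨ cong (G m (suc m) +_) (trans (sumTo-cong m (λ s s≤m → pascal-excess-split m s s≤m t≢0))
                                        (sumTo-linear m t c (G-term m (suc m)) (G-term m m))) ⟩
      G m (suc m) + (t * G m (suc m) - c * G m m)
        ≡⟨ factor t c (G m (suc m)) (G m m) ⟩
      (1ℚ + t) * G m (suc m) - t * (1ℚ - q * pow p m) * G m m
        ≡⟨ cong (λ x → (1ℚ + t) * G m (suc m) - t * (1ℚ - q * x) * G m m) (pow-square q m) ⟩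
      recurrenceStep q t (m ℕ.+ m) (G m (suc m)) (G m m) ∎
    where
      c = t * (1ℚ - q * pow p m)
      h′ = poch-≢0-pred p p m h
      bottom : G-term (suc m) (suc m) 0 ≡ G-term m (suc m) 0
      bottom = cong (1ℚ * 1ℚ * poch (- t) p (suc m) *_) (trans (qbin-n-0 p (suc m) h) (sym (qbin-n-0 p m h′)))
      top : G-term (suc m) (suc m) (suc m) ≡ pascal-excess m m
      top = cong (pow t (suc m ℕ.+ suc m) * poch (- u) p (suc m) * poch (- t) p (m ∸ m) *_) (begin
          qbin p (suc m) (suc m)    ≡⟨ qbin-n-n p (suc m) h ⟩
          1ℚ                        ≡⟨ trans (*-identityˡ (qbin p m m)) (qbin-n-n p m h′) ⟨
          1ℚ * qbin p m m           ≡⟨ cong (λ i → pow p i * qbin p m m) (ℕ.n∸n≡0 m) ⟨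
          pow p (m ∸ m) * qbin p m m ∎)
      factor : ∀ t c X Y → X + (t * X - c * Y) ≡ (1ℚ + t) * X - c * Y
      factor = solve-∀ ℚ-ring

  G-term-absorb : ∀ m r → r ≤ m → poch p p (suc m) ≢ 0ℚ →
    G-term (suc m) (suc (suc m)) r ≡ (1ℚ + t) * G-term (suc m) (suc m) r - t * (1ℚ - q * (q * pow p m)) * G-term m (suc m) r
  G-term-absorb m r r≤m h with ℕ.m≤n⇒∃[o]m+o≡n r≤m
  ... | d , refl = begin
      G-term (suc (r ℕ.+ d)) (suc (suc (r ℕ.+ d))) r
        ≡⟨ G-term-offset _ r (suc (suc d)) (trans (ℕ.+-suc r (suc d)) (cong suc (ℕ.+-suc r d))) ⟩
      F * (E * (1ℚ - - t * (p * pd))) * B₁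
        ≡⟨ split-factor t p pd F E B₁ ⟩
      (1ℚ + t) * (F * E * B₁) - t * (F * E) * ((1ℚ - p * pd) * B₁)
        ≡⟨ cong (λ x → (1ℚ + t) * (F * E * B₁) - t * (F * E) * x) (qbin-absorb p r d h) ⟩
      (1ℚ + t) * (F * E * B₁) - t * (F * E) * ((1ℚ - p * prd) * B₀)
        ≡⟨ regroup t q prd (F * E) B₀ ((1ℚ + t) * (F * E * B₁)) ⟩
      (1ℚ + t) * (F * E * B₁) - t * (1ℚ - q * (q * prd)) * (F * E * B₀)
        ≡⟨ cong₂ (λ x y → (1ℚ + t) * x - t * (1ℚ - q * (q * prd)) * y)
                 (sym (G-term-offset _ r (suc d) (ℕ.+-suc r d))) (sym (G-term-offset _ r (suc d) (ℕ.+-suc r d))) ⟩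
      (1ℚ + t) * G-term (suc (r ℕ.+ d)) (suc (r ℕ.+ d)) r - t * (1ℚ - q * (q * prd)) * G-term (r ℕ.+ d) (suc (r ℕ.+ d)) r ∎
    where
      F = pow t (r ℕ.+ r) * poch (- u) p r
      E = poch (- t) p (suc d)
      B₁ = qbin p (suc (r ℕ.+ d)) r
      B₀ = qbin p (r ℕ.+ d) r
      pd = pow p d
      prd = pow p (r ℕ.+ d)
      split-factor : ∀ t p pd F E B →
        F * (E * (1ℚ - - t * (p * pd))) * B ≡ (1ℚ + t) * (F * E * B) - t * (F * E) * ((1ℚ - p * pd) * B)
      split-factor = solve-∀ ℚ-ring
      regroup : ∀ t q prd FE B X → X - t * FE * ((1ℚ - q * q * prd) * B) ≡ X - t * (1ℚ - q * (q * prd)) * (FE * B)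
      regroup = solve-∀ ℚ-ring

  G-odd-step : ∀ m → poch p p (suc m) ≢ 0ℚ →
    G (suc m) (suc (suc m)) ≡ recurrenceStep q t (suc (m ℕ.+ m)) (G (suc m) (suc m)) (G m (suc m))
  G-odd-step m h = begin
      sumTo m (G-term (suc m) (suc (suc m))) + G-term (suc m) (suc (suc m)) (suc m)
        ≡⟨ cong₂ _+_ (trans (sumTo-cong m (λ r r≤m → G-term-absorb m r r≤m h))
                            (sumTo-linear m (1ℚ + t) c (G-term (suc m) (suc m)) (G-term m (suc m))))
                     top ⟩
      ((1ℚ + t) * Σ₁ - c * G m (suc m)) + (1ℚ + t) * Z
        ≡⟨ regroup t c Σ₁ (G m (suc m)) Z ⟩
      (1ℚ + t) * G (suc m) (suc m) - c * G m (suc m)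
        ≡⟨ cong (λ x → (1ℚ + t) * G (suc m) (suc m) - t * (1ℚ - q * (q * x)) * G m (suc m)) (pow-square q m) ⟩
      recurrenceStep q t (suc (m ℕ.+ m)) (G (suc m) (suc m)) (G m (suc m)) ∎
    where
      c = t * (1ℚ - q * (q * pow p m))
      Σ₁ = sumTo m (G-term (suc m) (suc m))
      F = pow t (suc m ℕ.+ suc m) * poch (- u) p (suc m)
      B = qbin p (suc m) (suc m)
      Z = G-term (suc m) (suc m) (suc m)
      unit-factor : ∀ t F B → F * (1ℚ * (1ℚ - - t * 1ℚ)) * B ≡ (1ℚ + t) * (F * 1ℚ * B)
      unit-factor = solve-∀ ℚ-ring
      top : G-term (suc m) (suc (suc m)) (suc m) ≡ (1ℚ + t) * Z
      top = begin
          G-term (suc m) (suc (suc m)) (suc m)  ≡⟨ G-term-offset (suc m) (suc m) 1 (cong suc (ℕ.+-comm m 1)) ⟩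
          F * (1ℚ * (1ℚ - - t * 1ℚ)) * B       ≡⟨ unit-factor t F B ⟩
          (1ℚ + t) * (F * 1ℚ * B)             ≡⟨ cong ((1ℚ + t) *_) (G-term-offset (suc m) (suc m) 0 (ℕ.+-identityʳ (suc m))) ⟨
          (1ℚ + t) * Z                        ∎
      regroup : ∀ t c X Y Z → ((1ℚ + t) * X - c * Y) + (1ℚ + t) * Z ≡ (1ℚ + t) * (X + Z) - c * Y
      regroup = solve-∀ ℚ-ring

data Parity : ℕ → Set where
  even : ∀ m → Parity (m ℕ.+ m)
  odd  : ∀ m → Parity (suc (m ℕ.+ m))

parity : ∀ n → Parity n
parity zero = even 0
parity (suc n) with parity n
... | even m = odd m
... | odd  m = subst Parity (cong suc (ℕ.+-suc m m)) (even (suc m))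

⌊m+m/2⌋≡m : ∀ m → ⌊ m ℕ.+ m /2⌋ ≡ m
⌊m+m/2⌋≡m m = sym (ℕ.n≡⌊n+n/2⌋ m)

⌊1+m+m/2⌋≡m : ∀ m → ⌊ suc (m ℕ.+ m) /2⌋ ≡ m
⌊1+m+m/2⌋≡m zero    = refl
⌊1+m+m/2⌋≡m (suc m) = cong suc (trans (cong ⌊_/2⌋ (ℕ.+-suc m m)) (⌊1+m+m/2⌋≡m m))

RHS-as-G : ∀ q t {n a b} → ⌊ n /2⌋ ≡ a → ⌊ suc n /2⌋ ≡ b → RHS q n t ≡ G q t a b
RHS-as-G q t refl refl = refl

RHS-recurrence : ∀ q t n → t ≢ 0ℚ → poch (q * q) (q * q) ⌊ suc (suc n) /2⌋ ≢ 0ℚ →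
  RHS q (suc (suc n)) t ≡ recurrenceStep q t n (RHS q (suc n) t) (RHS q n t)
RHS-recurrence q t n t≢0 h with parity n
... | even m = begin
    RHS q (suc (suc (m ℕ.+ m))) t  ≡⟨ RHS-as-G q t (cong suc e) (cong suc o) ⟩
    G q t (suc m) (suc m)          ≡⟨ G-even-step q t m t≢0 (subst (λ a → poch (q * q) (q * q) (suc a) ≢ 0ℚ) e h) ⟩
    recurrenceStep q t (m ℕ.+ m) (G q t m (suc m)) (G q t m m)
      ≡⟨ cong₂ (recurrenceStep q t (m ℕ.+ m)) (RHS-as-G q t o (cong suc e)) (RHS-as-G q t e o) ⟨
    recurrenceStep q t (m ℕ.+ m) (RHS q (suc (m ℕ.+ m)) t) (RHS q (m ℕ.+ m) t) ∎
  where
    e = ⌊m+m/2⌋≡m m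
    o = ⌊1+m+m/2⌋≡m m
... | odd m = begin
    RHS q (suc (suc (suc (m ℕ.+ m)))) t  ≡⟨ RHS-as-G q t (cong suc o) (cong (suc ∘ suc) e) ⟩
    G q t (suc m) (suc (suc m))          ≡⟨ G-odd-step q t m (subst (λ a → poch (q * q) (q * q) (suc a) ≢ 0ℚ) o h) ⟩
    recurrenceStep q t (suc (m ℕ.+ m)) (G q t (suc m) (suc m)) (G q t m (suc m))
      ≡⟨ cong₂ (recurrenceStep q t (suc (m ℕ.+ m))) (RHS-as-G q t (cong suc e) (cong suc o)) (RHS-as-G q t o (cong suc e)) ⟨
    recurrenceStep q t (suc (m ℕ.+ m)) (RHS q (suc (suc (m ℕ.+ m))) t) (RHS q (suc (m ℕ.+ m)) t) ∎
  where
    e = ⌊m+m/2⌋≡m m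
    o = ⌊1+m+m/2⌋≡m m

H₁≡RHS₁ : ∀ q t → poch q q 1 ≢ 0ℚ → H q 1 t ≡ RHS q 1 t
H₁≡RHS₁ q t h = begin
    1ℚ * qbin q 1 0 + t * 1ℚ * qbin q 1 1
      ≡⟨ cong₂ (λ a b → 1ℚ * a + t * 1ℚ * b) (qbin-n-0 q 1 h) (qbin-n-n q 1 h) ⟩
    1ℚ * 1ℚ + t * 1ℚ * 1ℚ
      ≡⟨ rearrange t ⟩
    1ℚ * 1ℚ * (1ℚ * (1ℚ - - t * 1ℚ)) * 1ℚ
      ≡⟨ cong (1ℚ * 1ℚ * (1ℚ * (1ℚ - - t * 1ℚ)) *_) (qbin-n-0 (q * q) 0 1≢0) ⟨
    RHS q 1 t ∎
  where
    rearrange : ∀ t → 1ℚ * 1ℚ + t * 1ℚ * 1ℚ ≡ 1ℚ * 1ℚ * (1ℚ * (1ℚ - - t * 1ℚ)) * 1ℚ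
    rearrange = solve-∀ ℚ-ring

theorem8p1 : (n : ℕ) (q t : ℚ) → t ≢ 0ℚ → poch q q n ≢ 0ℚ
    → poch (q * q) (q * q) ⌊ n /2⌋ ≢ 0ℚ → H q n t ≡ RHS q n t
theorem8p1 n q t t≢0 hq hp =
  second-order-recurrence-unique Nondegenerate nondegenerate-pred (recurrenceStep q t)
    (λ k → H q k t) (λ k → RHS q k t)
    refl (λ (h , _) → H₁≡RHS₁ q t h)
    (λ k (h , _) → H-recurrence q t k h) (λ k (_ , h) → RHS-recurrence q t k t≢0 h)
    n (hq , hp)
  where
    Nondegenerate : ℕ → Set
    Nondegenerate k = poch q q k ≢ 0ℚ × poch (q * q) (q * q) ⌊ k /2⌋ ≢ 0ℚ
    nondegenerate-pred : ∀ k → Nondegenerate (suc k) → Nondegenerate k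
    nondegenerate-pred k (hq , hp) = poch-≢0-pred q q k hq , poch-≢0-≤ (q * q) (q * q) (ℕ.⌊n/2⌋-mono (ℕ.n≤1+n k)) hp
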